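{- For integers $0<b_1<a_1$ and $0<b_2<a_2$, with $a=a_1+a_2$ and $b=b_1+b_2$, $$\binom{a_1}{b_1}\binom{a_2}{b_2}\le\binom{a}{b}\quad\text{and}\quad \binom{a_1}{b_1}\binom{a_2}{b_2}\leq\frac{2}{3}\sqrt{\frac{b(a-b)a_1a_2}{a\,b_1(a_1-b_1)b_2(a_2-b_2)}}\binom{a}{b}.$$ Moreover, for all integers $0<b<a$ and positive integers $k$, $$\binom{a}{b}^k\le\left(\frac{a}{b(a-b)}\right)^{(k-1)/2}\binom{ka}{kb},$$ and for all integers $0<b<a$, $$\binom{2a}{2b}\le 4\sqrt{\frac{b(a-b)}{a}}\binom{a}{b}^2\le 2\sqrt{a}\binom{a}{b}^2.$$ -}

module Defs where

open import Data.Nat using (ℕ; _+_; _*_; _∸_; _^_; _≤_; _<_)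
open import Data.Nat.Combinatorics using (_C_)
open import Data.Product using (_×_)

-- The sqrt inequality  X ≤ (2/3) √(N / D) · Y  (all quantities positive) is
-- stated in its squared, denominator-cleared form  9 · D · X² ≤ 4 · N · Y².
TwoBinomBounds : ℕ → ℕ → ℕ → ℕ → Set
TwoBinomBounds a₁ b₁ a₂ b₂ =
  let a = a₁ + a₂
      b = b₁ + b₂
      X = (a₁ C b₁) * (a₂ C b₂)
      Y = a C b
  in (X ≤ Y)
     × (9 * (a * (b₁ * (a₁ ∸ b₁)) * (b₂ * (a₂ ∸ b₂))) * X ^ 2
          ≤ 4 * (b * (a ∸ b) * a₁ * a₂) * Y ^ 2)

-- Part 3:  C(a,b)^k ≤ (a / (b(a-b)))^((k-1)/2) · C(ka,kb), squared and cleared: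
--   C(a,b)^(2k) · (b(a-b))^(k-1) ≤ a^(k-1) · C(ka,kb)^2.
PowerBound : ℕ → ℕ → ℕ → Set
PowerBound a b k =
  (a C b) ^ (2 * k) * (b * (a ∸ b)) ^ (k ∸ 1) ≤ a ^ (k ∸ 1) * ((k * a) C (k * b)) ^ 2

-- Part 4:  C(2a,2b) ≤ 4 √(b(a-b)/a) C(a,b)² ≤ 2 √a C(a,b)², squared and cleared:
--   a · C(2a,2b)² ≤ 16 · b(a-b) · C(a,b)⁴   and   16 · b(a-b) · C(a,b)⁴ ≤ 4 · a² · C(a,b)⁴.
DoubleBound : ℕ → ℕ → Set
DoubleBound a b =
  (a * ((2 * a) C (2 * b)) ^ 2 ≤ 16 * (b * (a ∸ b)) * (a C b) ^ 4)
  × (16 * (b * (a ∸ b)) * (a C b) ^ 4 ≤ 4 * a ^ 2 * (a C b) ^ 4)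

{-# OPTIONS --safe #-}
module Submission where

-- The first inequality compares the Vandermonde convolution with one of its terms.  For the
-- second, with c = a − b throughout, put
--   φ(x, y) = x y C(x+y, x)⁴ / ((x + y) C(2x+2y, 2x)²).
-- Since C(2x,x) C(2y,y) C(2x+2y, 2x) = C(2x+2y, x+y) C(x+y, x)², the Wallis-type bounds
-- (5/4) 16ⁿ / (4n + 1) ≤ C(2n, n)² ≤ 16ⁿ / (3n + 1) confine φ to [1/5, 2/5], so
-- 9 φ(b₁, c₁) φ(b₂, c₂) ≤ 8 φ(b₁ + b₂, c₁ + c₂).  This says that the quotient Q of the two sides of
-- the squared inequality at least squares when all of b₁, c₁, b₂, c₂ are doubled, while the first
-- inequality bounds Q linearly in the scale.  Hence Q^(2^k) = O(2^k), which forces Q ≤ 1.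
-- The third inequality follows by induction on k from the second applied to (a, b) and
-- (k a, k b), and the fourth from φ ≥ 1/5 together with 4 b (a − b) ≤ a².

open import Defs
open import Data.Nat using (ℕ; _<_; _≤_)
open import Data.Product using (_×_)

open import Data.Nat using (zero; suc; _+_; _*_; _∸_; _^_; _!; NonZero; >-nonZero; ≢-nonZero; z≤n; z<s; s<s)
open import Data.Nat.Combinatorics using (_C_; nCk≡n!/k![n-k]!; k![n∸k]!∣n!; nCk+nC[k+1]≡[n+1]C[k+1])
open import Data.Nat.DivMod using (m/n*n≡m)
open import Data.Nat.Properties
open import Algebra.Properties.CommutativeSemigroup +-commutativeSemigroup
  using () renaming (interchange to +-interchange)
open import Data.Nat.Tactic.RingSolver using (solve-∀)
open import Data.Product using (_,_)
open import Data.Sum using ([_,_]′)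
open import Function using (_∘_)
open import Relation.Binary.PropositionalEquality
open import Relation.Nullary using (¬_)

m^2≡m*m : ∀ m → m ^ 2 ≡ m * m
m^2≡m*m m = cong (m *_) (*-identityʳ m)

m^4≡m*m*[m*m] : ∀ m → m ^ 4 ≡ m * m * (m * m)
m^4≡m*m*[m*m] m = trans (cong (λ z → m * (m * z)) (m^2≡m*m m)) (sym (*-assoc m m (m * m)))

^-double : ∀ x n → x ^ (2 * n) ≡ x ^ n * x ^ n
^-double x n = trans (cong (x ^_) (cong (n +_) (+-identityʳ n))) (^-distribˡ-+-* x n n)

4mn≤[m+n]² : ∀ m n → 4 * (m * n) ≤ (m + n) * (m + n)
4mn≤[m+n]² m n =
  [ below , subst₂ _≤_ (cong (4 *_) (*-comm n m)) (cong (λ s → s * s) (+-comm n m)) ∘ below ]′ (≤-total m n)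
  where
  expand : ∀ m d → 4 * (m * (m + d)) + d * d ≡ (m + (m + d)) * (m + (m + d))
  expand = solve-∀
  below : ∀ {m n} → m ≤ n → 4 * (m * n) ≤ (m + n) * (m + n)
  below {m} {n} m≤n with n ∸ m | m+[n∸m]≡n m≤n
  ... | d | refl = ≤-trans (m≤m+n _ (d * d)) (≤-reflexive (expand m d))

n<2^n : ∀ n → n < 2 ^ n
n<2^n zero    = z<s
n<2^n (suc n) = begin-strict
  suc n         <⟨ s<s (n<2^n n) ⟩
  1 + 2 ^ n     ≤⟨ +-monoˡ-≤ (2 ^ n) (m^n>0 2 n) ⟩
  2 ^ n + 2 ^ n ≡⟨ cong (2 ^ n +_) (+-identityʳ (2 ^ n)) ⟨
  2 ^ suc n     ∎
  where open ≤-Reasoning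

bernoulli : ∀ r m → r ^ m * (r + m) ≤ suc r ^ m * r
bernoulli r zero    = ≤-reflexive (cong (1 *_) (+-identityʳ r))
bernoulli r (suc m) = begin
  r * r ^ m * (r + suc m)              ≤⟨ m≤m+n _ (m * r ^ m) ⟩
  r * r ^ m * (r + suc m) + m * r ^ m  ≡⟨ collect r m (r ^ m) ⟩
  suc r * (r ^ m * (r + m))            ≤⟨ *-monoʳ-≤ (suc r) (bernoulli r m) ⟩
  suc r * (suc r ^ m * r)              ≡⟨ *-assoc (suc r) (suc r ^ m) r ⟨
  suc r * suc r ^ m * r                ∎
  where
  open ≤-Reasoning
  collect : ∀ r m w → r * w * (r + suc m) + m * w ≡ suc r * (w * (r + m))
  collect = solve-∀

-- With m = 2 ^ j, Bernoulli gives r ^ m * m ≤ (1 + r) ^ m * r; squaring it and using the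
-- hypothesis at k = 1 + j yields m ≤ 2 c r² = j, contradicting j < 2 ^ j.
¬[1+r]^2^k≤c*2^k*r^2^k : ∀ r c → .{{NonZero r}} → ¬ (∀ k → suc r ^ 2 ^ k ≤ c * 2 ^ k * r ^ 2 ^ k)
¬[1+r]^2^k≤c*2^k*r^2^k r c bounded = <⇒≱ (n<2^n j) m≤j
  where
  open ≤-Reasoning
  j = 2 * c * (r * r)
  m = 2 ^ j
  rᵐm≤[1+r]ᵐr : r ^ m * m ≤ suc r ^ m * r
  rᵐm≤[1+r]ᵐr = ≤-trans (*-monoʳ-≤ (r ^ m) (m≤n+m m r)) (bernoulli r m)
  regroup : ∀ w m → w * w * (m * m) ≡ (w * m) * (w * m)
  regroup = solve-∀
  collect : ∀ c m w r → c * (2 * m) * (w * w) * (r * r) ≡ w * w * (2 * c * (r * r) * m)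
  collect = solve-∀
  m*m≤j*m : r ^ m * r ^ m * (m * m) ≤ r ^ m * r ^ m * (j * m)
  m*m≤j*m = begin
    r ^ m * r ^ m * (m * m)                 ≡⟨ regroup (r ^ m) m ⟩
    (r ^ m * m) * (r ^ m * m)               ≤⟨ *-mono-≤ rᵐm≤[1+r]ᵐr rᵐm≤[1+r]ᵐr ⟩
    (suc r ^ m * r) * (suc r ^ m * r)       ≡⟨ regroup (suc r ^ m) r ⟨
    suc r ^ m * suc r ^ m * (r * r)         ≡⟨ cong (_* (r * r)) (^-double (suc r) m) ⟨
    suc r ^ (2 * m) * (r * r)               ≤⟨ *-monoˡ-≤ (r * r) (bounded (suc j)) ⟩
    c * (2 * m) * r ^ (2 * m) * (r * r)     ≡⟨ cong (λ z → c * (2 * m) * z * (r * r)) (^-double r m) ⟩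
    c * (2 * m) * (r ^ m * r ^ m) * (r * r) ≡⟨ collect c m (r ^ m) r ⟩
    r ^ m * r ^ m * (j * m)                 ∎
  m≤j : m ≤ j
  m≤j = *-cancelʳ-≤ m j m {{m^n≢0 2 j}}
          (*-cancelˡ-≤ (r ^ m * r ^ m) {{m*n≢0 _ _ {{m^n≢0 r m}} {{m^n≢0 r m}}}} m*m≤j*m)

tensor-power-trick : ∀ (P R : ℕ → ℕ) c → (∀ k → NonZero (R k)) →
  (∀ k → P k * P k * R (suc k) ≤ P (suc k) * (R k * R k)) →
  (∀ k → P k ≤ c * 2 ^ k * R k) →
  P 0 ≤ R 0
tensor-power-trick P R c R≢0 doubling linear = ≮⇒≥ λ R₀<P₀ →
  ¬[1+r]^2^k≤c*2^k*r^2^k (R 0) c {{R≢0 0}} λ k → ≤-trans (^-monoˡ-≤ (2 ^ k) R₀<P₀) (powers k)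
  where
  open ≤-Reasoning
  swap : ∀ p u v → p * u * v ≡ p * v * u
  swap = solve-∀
  iterated : ∀ k → P 0 ^ 2 ^ k * R k ≤ P k * R 0 ^ 2 ^ k
  iterated zero    = ≤-reflexive (trans (swap (P 0) 1 (R 0)) (*-assoc (P 0) (R 0) 1))
  iterated (suc k) = *-cancelʳ-≤ _ _ (R k * R k) {{m*n≢0 _ _ {{R≢0 k}} {{R≢0 k}}}} (begin
    P 0 ^ (2 * K) * R (suc k) * (R k * R k)   ≡⟨ cong (λ z → z * R (suc k) * (R k * R k)) (^-double (P 0) K) ⟩
    p * p * R (suc k) * (R k * R k)           ≡⟨ regroup p (R (suc k)) (R k) ⟩
    (p * R k) * (p * R k) * R (suc k)         ≤⟨ *-monoˡ-≤ (R (suc k)) (*-mono-≤ (iterated k) (iterated k)) ⟩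
    (P k * r) * (P k * r) * R (suc k)         ≡⟨ regroup (P k) (R (suc k)) r ⟨
    P k * P k * R (suc k) * (r * r)           ≤⟨ *-monoˡ-≤ (r * r) (doubling k) ⟩
    P (suc k) * (R k * R k) * (r * r)         ≡⟨ swap (P (suc k)) (R k * R k) (r * r) ⟩
    P (suc k) * (r * r) * (R k * R k)         ≡⟨ cong (λ z → P (suc k) * z * (R k * R k)) (^-double (R 0) K) ⟨
    P (suc k) * R 0 ^ (2 * K) * (R k * R k)   ∎)
    where
    K = 2 ^ k
    p = P 0 ^ K
    r = R 0 ^ K
    regroup : ∀ p q r → p * p * q * (r * r) ≡ (p * r) * (p * r) * q
    regroup = solve-∀
  powers : ∀ k → P 0 ^ 2 ^ k ≤ c * 2 ^ k * R 0 ^ 2 ^ k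
  powers k = *-cancelʳ-≤ _ _ (R k) {{R≢0 k}} (begin
    P 0 ^ 2 ^ k * R k               ≤⟨ iterated k ⟩
    P k * R 0 ^ 2 ^ k               ≤⟨ *-monoˡ-≤ (R 0 ^ 2 ^ k) (linear k) ⟩
    c * 2 ^ k * R k * R 0 ^ 2 ^ k   ≡⟨ swap (c * 2 ^ k) (R k) (R 0 ^ 2 ^ k) ⟩
    c * 2 ^ k * R 0 ^ 2 ^ k * R k   ∎)

proportional-squares-≤ : ∀ {A B p q r s} → p * s ≡ q * r → .{{NonZero q}} →
                         A * (p * p) ≤ B * (q * q) → A * (r * r) ≤ B * (s * s)
proportional-squares-≤ {A} {B} {p} {q} {r} {s} ps≡qr Ap²≤Bq² =
  *-cancelʳ-≤ _ _ (q * q) {{m*n≢0 q q}} (begin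
    A * (r * r) * (q * q)   ≡⟨ swap A (r * r) (q * q) ⟩
    A * (q * q) * (r * r)   ≡⟨ square-product A q r ⟨
    A * ((q * r) * (q * r)) ≡⟨ cong (λ z → A * (z * z)) ps≡qr ⟨
    A * ((p * s) * (p * s)) ≡⟨ square-product A p s ⟩
    A * (p * p) * (s * s)   ≤⟨ *-monoˡ-≤ (s * s) Ap²≤Bq² ⟩
    B * (q * q) * (s * s)   ≡⟨ swap B (q * q) (s * s) ⟩
    B * (s * s) * (q * q)   ∎)
  where
  open ≤-Reasoning
  swap : ∀ a u v → a * u * v ≡ a * v * u
  swap = solve-∀
  square-product : ∀ a u v → a * ((u * v) * (u * v)) ≡ a * (u * u) * (v * v)
  square-product = solve-∀

-- Binomial and central binomial coefficients

-- Working with b and c = a − b rather than a and b keeps truncated subtraction out of the arithmetic.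
binom : ℕ → ℕ → ℕ
binom x y = (x + y) C x

binom-factorial : ∀ x y → binom x y * (x ! * y !) ≡ (x + y) !
binom-factorial x y = subst (λ z → binom x y * (x ! * z !) ≡ (x + y) !) (m+n∸m≡n x y)
  (trans (cong (_* (x ! * (x + y ∸ x) !)) (nCk≡n!/k![n-k]! x≤x+y))
         (m/n*n≡m {{x !* (x + y ∸ x) !≢0}} (k![n∸k]!∣n! x≤x+y)))
  where x≤x+y = m≤m+n x y

binom-nonZero : ∀ x y → NonZero (binom x y)
binom-nonZero x y = ≢-nonZero λ binom≡0 →
  n>0⇒n≢0 (1≤n! (x + y)) (trans (sym (binom-factorial x y)) (cong (_* (x ! * y !)) binom≡0))

nCk≤[1+n]Ck : ∀ n k → n C k ≤ suc n C k
nCk≤[1+n]Ck n zero    = ≤-refl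
nCk≤[1+n]Ck n (suc k) = subst (n C suc k ≤_) (nCk+nC[k+1]≡[n+1]C[k+1] n k) (m≤n+m _ _)

mCj*nCk≤[m+n]C[j+k] : ∀ m j n k → (m C j) * (n C k) ≤ (m + n) C (j + k)
mCj*nCk≤[m+n]C[j+k] m j zero zero
  rewrite *-identityʳ (m C j) | +-identityʳ m | +-identityʳ j = ≤-refl
mCj*nCk≤[m+n]C[j+k] m j zero (suc k)
  rewrite *-zeroʳ (m C j) = z≤n
mCj*nCk≤[m+n]C[j+k] m j (suc n) zero = begin
  (m C j) * 1              ≤⟨ mCj*nCk≤[m+n]C[j+k] m j n zero ⟩
  (m + n) C (j + 0)        ≤⟨ nCk≤[1+n]Ck (m + n) (j + 0) ⟩
  suc (m + n) C (j + 0)    ≡⟨ cong (_C (j + 0)) (+-suc m n) ⟨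
  (m + suc n) C (j + 0)    ∎
  where open ≤-Reasoning
mCj*nCk≤[m+n]C[j+k] m j (suc n) (suc k) = begin
  (m C j) * (suc n C suc k)
    ≡⟨ cong ((m C j) *_) (nCk+nC[k+1]≡[n+1]C[k+1] n k) ⟨
  (m C j) * (n C k + n C suc k)
    ≡⟨ *-distribˡ-+ (m C j) (n C k) (n C suc k) ⟩
  (m C j) * (n C k) + (m C j) * (n C suc k)
    ≤⟨ +-mono-≤ (mCj*nCk≤[m+n]C[j+k] m j n k) (mCj*nCk≤[m+n]C[j+k] m j n (suc k)) ⟩
  (m + n) C (j + k) + (m + n) C (j + suc k)
    ≡⟨ cong (λ i → (m + n) C (j + k) + (m + n) C i) (+-suc j k) ⟩
  (m + n) C (j + k) + (m + n) C suc (j + k)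
    ≡⟨ nCk+nC[k+1]≡[n+1]C[k+1] (m + n) (j + k) ⟩
  suc (m + n) C suc (j + k)
    ≡⟨ cong₂ _C_ (+-suc m n) (+-suc j k) ⟨
  (m + suc n) C (j + suc k) ∎
  where open ≤-Reasoning

central : ℕ → ℕ
central n = binom n n

central-step : ∀ n → suc n * central (suc n) ≡ 2 * (2 * n + 1) * central n
central-step n = *-cancelʳ-≡ _ _ (suc n * (n ! * n !)) {{m*n≢0 (suc n) (n ! * n !) {{_}} {{n !* n !≢0}}}} (begin
  suc n * central (suc n) * (suc n * (n ! * n !))
    ≡⟨ regroup (suc n) (central (suc n)) (n !) ⟩
  central (suc n) * (suc n ! * suc n !)
    ≡⟨ binom-factorial (suc n) (suc n) ⟩
  (suc n + suc n) !
    ≡⟨ cong _! (+-suc (suc n) n) ⟩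
  (2 + (n + n)) !
    ≡⟨ cong (λ z → (2 + (n + n)) * ((1 + (n + n)) * z)) (binom-factorial n n) ⟨
  (2 + (n + n)) * ((1 + (n + n)) * (central n * (n ! * n !)))
    ≡⟨ collect n (central n) (n !) ⟩
  2 * (2 * n + 1) * central n * (suc n * (n ! * n !)) ∎)
  where
  open ≡-Reasoning
  regroup : ∀ s c f → s * c * (s * (f * f)) ≡ c * (s * f * (s * f))
  regroup = solve-∀
  collect : ∀ n c f → (2 + (n + n)) * ((1 + (n + n)) * (c * (f * f))) ≡ 2 * (2 * n + 1) * c * (suc n * (f * f))
  collect = solve-∀

central-upper : ∀ n → (1 + 3 * n) * (central n * central n) ≤ 16 ^ n
central-upper zero    = ≤-refl
central-upper (suc n) = *-cancelʳ-≤ _ _ (suc n * suc n) (begin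
  (1 + 3 * suc n) * (central (suc n) * central (suc n)) * (suc n * suc n)
    ≡⟨ square-product (1 + 3 * suc n) (suc n) (central (suc n)) ⟨
  (1 + 3 * suc n) * ((suc n * central (suc n)) * (suc n * central (suc n)))
    ≡⟨ cong (λ z → (1 + 3 * suc n) * (z * z)) (central-step n) ⟩
  (1 + 3 * suc n) * ((2 * (2 * n + 1) * central n) * (2 * (2 * n + 1) * central n))
    ≤⟨ m≤m+n _ (4 * n * (central n * central n)) ⟩
  (1 + 3 * suc n) * ((2 * (2 * n + 1) * central n) * (2 * (2 * n + 1) * central n))
    + 4 * n * (central n * central n)
    ≡⟨ expand n (central n) ⟩
  16 * (suc n * suc n) * ((1 + 3 * n) * (central n * central n))
    ≤⟨ *-monoʳ-≤ (16 * (suc n * suc n)) (central-upper n) ⟩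
  16 * (suc n * suc n) * 16 ^ n
    ≡⟨ swap 16 (suc n * suc n) (16 ^ n) ⟩
  16 ^ suc n * (suc n * suc n) ∎)
  where
  open ≤-Reasoning
  square-product : ∀ a s c → a * ((s * c) * (s * c)) ≡ a * (c * c) * (s * s)
  square-product = solve-∀
  expand : ∀ n c → (1 + 3 * suc n) * ((2 * (2 * n + 1) * c) * (2 * (2 * n + 1) * c)) + 4 * n * (c * c)
                 ≡ 16 * (suc n * suc n) * ((1 + 3 * n) * (c * c))
  expand = solve-∀
  swap : ∀ a u v → a * u * v ≡ a * v * u
  swap = solve-∀

-- The factor 5 matters: the weaker 16ⁿ ≤ (1 + 4n) C(2n, n)² would not give doubling-ratio.
central-lower : ∀ n → 5 * 16 ^ suc n ≤ 4 * (1 + 4 * suc n) * (central (suc n) * central (suc n))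
central-lower zero    = ≤-refl
central-lower (suc n) = *-cancelʳ-≤ _ _ (suc m * suc m) (begin
  5 * 16 ^ suc m * (suc m * suc m)
    ≡⟨ regroup (16 ^ m) (suc m * suc m) ⟩
  16 * (suc m * suc m) * (5 * 16 ^ m)
    ≤⟨ *-monoʳ-≤ (16 * (suc m * suc m)) (central-lower n) ⟩
  16 * (suc m * suc m) * (4 * (1 + 4 * m) * (central m * central m))
    ≤⟨ m≤m+n _ (16 * (central m * central m)) ⟩
  16 * (suc m * suc m) * (4 * (1 + 4 * m) * (central m * central m)) + 16 * (central m * central m)
    ≡⟨ expand m (central m) ⟩
  4 * (1 + 4 * suc m) * ((2 * (2 * m + 1) * central m) * (2 * (2 * m + 1) * central m))
    ≡⟨ cong (λ z → 4 * (1 + 4 * suc m) * (z * z)) (central-step m) ⟨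
  4 * (1 + 4 * suc m) * ((suc m * central (suc m)) * (suc m * central (suc m)))
    ≡⟨ square-product (4 * (1 + 4 * suc m)) (suc m) (central (suc m)) ⟩
  4 * (1 + 4 * suc m) * (central (suc m) * central (suc m)) * (suc m * suc m) ∎)
  where
  open ≤-Reasoning
  m = suc n
  regroup : ∀ p s → 5 * (16 * p) * s ≡ 16 * s * (5 * p)
  regroup = solve-∀
  expand : ∀ m c → 16 * (suc m * suc m) * (4 * (1 + 4 * m) * (c * c)) + 16 * (c * c)
                 ≡ 4 * (1 + 4 * suc m) * ((2 * (2 * m + 1) * c) * (2 * (2 * m + 1) * c))
  expand = solve-∀
  square-product : ∀ a s c → a * ((s * c) * (s * c)) ≡ a * (c * c) * (s * s)
  square-product = solve-∀

binom-double : ∀ x y → central x * central y * binom (2 * x) (2 * y) ≡ central (x + y) * (binom x y * binom x y)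
binom-double x y = *-cancelʳ-≡ _ _ (x ! * x ! * (y ! * y !)) {{m*n≢0 _ _ {{x !* x !≢0}} {{y !* y !≢0}}}} (begin
  central x * central y * binom (2 * x) (2 * y) * (x ! * x ! * (y ! * y !))
    ≡⟨ regroup (binom (2 * x) (2 * y)) (central x) (central y) (x ! * x !) (y ! * y !) ⟩
  binom (2 * x) (2 * y) * (central x * (x ! * x !) * (central y * (y ! * y !)))
    ≡⟨ cong₂ (λ u v → binom (2 * x) (2 * y) * (u * v)) (binom-factorial x x) (binom-factorial y y) ⟩
  binom (2 * x) (2 * y) * ((x + x) ! * (y + y) !)
    ≡⟨ cong₂ (λ u v → binom (2 * x) (2 * y) * (u ! * v !)) (x+x≡2*x x) (x+x≡2*x y) ⟩
  binom (2 * x) (2 * y) * ((2 * x) ! * (2 * y) !)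
    ≡⟨ binom-factorial (2 * x) (2 * y) ⟩
  (2 * x + 2 * y) !
    ≡⟨ cong _! (2x+2y≡[x+y]+[x+y] x y) ⟩
  (x + y + (x + y)) !
    ≡⟨ binom-factorial (x + y) (x + y) ⟨
  central (x + y) * ((x + y) ! * (x + y) !)
    ≡⟨ cong (λ u → central (x + y) * (u * u)) (binom-factorial x y) ⟨
  central (x + y) * (binom x y * (x ! * y !) * (binom x y * (x ! * y !)))
    ≡⟨ collect (central (x + y)) (binom x y) (x !) (y !) ⟩
  central (x + y) * (binom x y * binom x y) * (x ! * x ! * (y ! * y !)) ∎)
  where
  open ≡-Reasoning
  regroup : ∀ d c c′ f f′ → c * c′ * d * (f * f′) ≡ d * (c * f * (c′ * f′))
  regroup = solve-∀
  x+x≡2*x : ∀ x → x + x ≡ 2 * x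
  x+x≡2*x = solve-∀
  2x+2y≡[x+y]+[x+y] : ∀ x y → 2 * x + 2 * y ≡ x + y + (x + y)
  2x+2y≡[x+y]+[x+y] = solve-∀
  collect : ∀ c b f f′ → c * (b * (f * f′) * (b * (f * f′))) ≡ c * (b * b) * (f * f * (f′ * f′))
  collect = solve-∀

central-product-upper : ∀ x y → .{{NonZero x}} →
  5 * (x * y) * (central x * central y * (central x * central y))
    ≤ 2 * (x + y) * (central (x + y) * central (x + y))
central-product-upper x@(suc s) y = *-cancelʳ-≤ _ _ ((1 + 3 * x) * (1 + 3 * y)) {{m*n≢0 (1 + 3 * x) (1 + 3 * y)}} (begin
  5 * (x * y) * (Zx * Zy * (Zx * Zy)) * ((1 + 3 * x) * (1 + 3 * y))
    ≡⟨ regroup (x * y) (1 + 3 * x) (1 + 3 * y) Zx Zy ⟩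
  5 * (x * y) * ((1 + 3 * x) * (Zx * Zx) * ((1 + 3 * y) * (Zy * Zy)))
    ≤⟨ *-monoʳ-≤ (5 * (x * y)) (*-mono-≤ (central-upper x) (central-upper y)) ⟩
  5 * (x * y) * (16 ^ x * 16 ^ y)
    ≡⟨ cong (λ z → 5 * (x * y) * z) (^-distribˡ-+-* 16 x y) ⟨
  5 * (x * y) * 16 ^ (x + y)
    ≡⟨ move-5 (x * y) (16 ^ (x + y)) ⟩
  x * y * (5 * 16 ^ (x + y))
    ≤⟨ *-monoʳ-≤ (x * y) (central-lower (s + y)) ⟩
  x * y * (4 * (1 + 4 * (x + y)) * (Zn * Zn))
    ≡⟨ pull-4 (x * y) (1 + 4 * (x + y)) (Zn * Zn) ⟩
  4 * (x * y) * (1 + 4 * (x + y)) * (Zn * Zn)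
    ≤⟨ *-monoˡ-≤ (Zn * Zn) polynomial ⟩
  2 * (x + y) * ((1 + 3 * x) * (1 + 3 * y)) * (Zn * Zn)
    ≡⟨ swap (2 * (x + y)) ((1 + 3 * x) * (1 + 3 * y)) (Zn * Zn) ⟩
  2 * (x + y) * (Zn * Zn) * ((1 + 3 * x) * (1 + 3 * y)) ∎)
  where
  open ≤-Reasoning
  Zx = central x
  Zy = central y
  Zn = central (x + y)
  expand : ∀ x y → 4 * (x * y) * (1 + 4 * (x + y)) + 2 * (x * (1 + 4 * y + y * y + 3 * x + x * y) + y * (1 + 3 * y))
                 ≡ 2 * (x + y) * ((1 + 3 * x) * (1 + 3 * y))
  expand = solve-∀
  polynomial : 4 * (x * y) * (1 + 4 * (x + y)) ≤ 2 * (x + y) * ((1 + 3 * x) * (1 + 3 * y))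
  polynomial = ≤-trans (m≤m+n _ (2 * (x * (1 + 4 * y + y * y + 3 * x + x * y) + y * (1 + 3 * y))))
                       (≤-reflexive (expand x y))
  regroup : ∀ a u v c c′ → 5 * a * (c * c′ * (c * c′)) * (u * v) ≡ 5 * a * (u * (c * c) * (v * (c′ * c′)))
  regroup = solve-∀
  move-5 : ∀ a p → 5 * a * p ≡ a * (5 * p)
  move-5 = solve-∀
  pull-4 : ∀ a u w → a * (4 * u * w) ≡ 4 * a * u * w
  pull-4 = solve-∀
  swap : ∀ a u w → a * u * w ≡ a * w * u
  swap = solve-∀

central-product-lower : ∀ x y → .{{NonZero x}} → .{{NonZero y}} →
  (x + y) * (central (x + y) * central (x + y))
    ≤ 5 * (x * y) * (central x * central y * (central x * central y))
central-product-lower x@(suc s) y@(suc t) = *-cancelʳ-≤ _ _ (25 * (1 + 3 * (x + y))) (begin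
  (x + y) * (Zn * Zn) * (25 * (1 + 3 * (x + y)))
    ≡⟨ pull-25 (x + y) (1 + 3 * (x + y)) (Zn * Zn) ⟩
  25 * (x + y) * ((1 + 3 * (x + y)) * (Zn * Zn))
    ≤⟨ *-monoʳ-≤ (25 * (x + y)) (central-upper (x + y)) ⟩
  25 * (x + y) * 16 ^ (x + y)
    ≡⟨ cong (λ z → 25 * (x + y) * z) (^-distribˡ-+-* 16 x y) ⟩
  25 * (x + y) * (16 ^ x * 16 ^ y)
    ≡⟨ split-25 (x + y) (16 ^ x) (16 ^ y) ⟩
  (x + y) * (5 * 16 ^ x * (5 * 16 ^ y))
    ≤⟨ *-monoʳ-≤ (x + y) (*-mono-≤ (central-lower s) (central-lower t)) ⟩
  (x + y) * (4 * (1 + 4 * x) * (Zx * Zx) * (4 * (1 + 4 * y) * (Zy * Zy)))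
    ≡⟨ regroupˡ (x + y) (1 + 4 * x) (1 + 4 * y) Zx Zy ⟩
  16 * (x + y) * ((1 + 4 * x) * (1 + 4 * y)) * (Zx * Zx * (Zy * Zy))
    ≤⟨ *-monoˡ-≤ (Zx * Zx * (Zy * Zy)) polynomial ⟩
  125 * (x * y) * (1 + 3 * (x + y)) * (Zx * Zx * (Zy * Zy))
    ≡⟨ regroupʳ (x * y) (1 + 3 * (x + y)) Zx Zy ⟩
  5 * (x * y) * (Zx * Zy * (Zx * Zy)) * (25 * (1 + 3 * (x + y))) ∎)
  where
  open ≤-Reasoning
  Zx = central x
  Zy = central y
  Zn = central (x + y)
  expand : ∀ s t → 16 * (suc s + suc t) * ((1 + 4 * suc s) * (1 + 4 * suc t))
                     + (75 + 210 * (s + t) + 55 * (s * s + t * t) + 473 * (s * t) + 119 * (s * t * (s + t)))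
                 ≡ 125 * (suc s * suc t) * (1 + 3 * (suc s + suc t))
  expand = solve-∀
  polynomial : 16 * (x + y) * ((1 + 4 * x) * (1 + 4 * y)) ≤ 125 * (x * y) * (1 + 3 * (x + y))
  polynomial = ≤-trans (m≤m+n _ (75 + 210 * (s + t) + 55 * (s * s + t * t) + 473 * (s * t) + 119 * (s * t * (s + t))))
                       (≤-reflexive (expand s t))
  pull-25 : ∀ n u w → n * w * (25 * u) ≡ 25 * n * (u * w)
  pull-25 = solve-∀
  split-25 : ∀ n p q → 25 * n * (p * q) ≡ n * (5 * p * (5 * q))
  split-25 = solve-∀
  regroupˡ : ∀ n u v c c′ → n * (4 * u * (c * c) * (4 * v * (c′ * c′))) ≡ 16 * n * (u * v) * (c * c * (c′ * c′))
  regroupˡ = solve-∀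
  regroupʳ : ∀ a u c c′ → 125 * a * u * (c * c * (c′ * c′)) ≡ 5 * a * (c * c′ * (c * c′)) * (25 * u)
  regroupʳ = solve-∀

-- φ(x, y) = doublingNum x y / doublingDen x y, which by binom-double equals
-- x y (C(2x, x) C(2y, y))² / ((x + y) C(2x+2y, x+y)²).
doublingNum doublingDen : ℕ → ℕ → ℕ
doublingNum x y = x * y * (binom x y * binom x y * (binom x y * binom x y))
doublingDen x y = (x + y) * (binom (2 * x) (2 * y) * binom (2 * x) (2 * y))

binom-double-lower : ∀ x y → .{{NonZero x}} → 5 * doublingNum x y ≤ 2 * doublingDen x y
binom-double-lower x y = subst₂ _≤_ (*-assoc 5 (x * y) _) (*-assoc 2 (x + y) _)
  (proportional-squares-≤ {5 * (x * y)} {2 * (x + y)} {central x * central y} {central (x + y)}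
    (binom-double x y) {{binom-nonZero (x + y) (x + y)}} (central-product-upper x y))

binom-double-upper : ∀ x y → .{{NonZero x}} → .{{NonZero y}} → doublingDen x y ≤ 5 * doublingNum x y
binom-double-upper x y = subst (doublingDen x y ≤_) (*-assoc 5 (x * y) _)
  (proportional-squares-≤ {x + y} {5 * (x * y)} {central (x + y)} {central x * central y}
    (sym (binom-double x y)) {{m*n≢0 _ _ {{binom-nonZero x x}} {{binom-nonZero y y}}}}
    (central-product-lower x y))

doubling-ratio : ∀ b₁ c₁ b₂ c₂ → .{{NonZero b₁}} → .{{NonZero c₁}} → .{{NonZero b₂}} →
  9 * (doublingNum b₁ c₁ * doublingNum b₂ c₂ * doublingDen (b₁ + b₂) (c₁ + c₂))
    ≤ 8 * (doublingDen b₁ c₁ * doublingDen b₂ c₂ * doublingNum (b₁ + b₂) (c₁ + c₂))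
doubling-ratio b₁@(suc _) c₁@(suc _) b₂ c₂ = *-cancelˡ-≤ 25 (begin
  25 * (9 * (n₁ * n₂ * d₃))          ≡⟨ regroupˡ n₁ n₂ d₃ ⟩
  9 * (5 * n₁ * (5 * n₂) * d₃)       ≤⟨ *-monoʳ-≤ 9 (*-mono-≤ (*-mono-≤ (binom-double-lower b₁ c₁)
                                                                    (binom-double-lower b₂ c₂))
                                                         (binom-double-upper (b₁ + b₂) (c₁ + c₂))) ⟩
  9 * (2 * d₁ * (2 * d₂) * (5 * n₃)) ≡⟨ regroupʳ d₁ d₂ n₃ ⟩
  180 * (d₁ * d₂ * n₃)               ≤⟨ *-monoˡ-≤ (d₁ * d₂ * n₃) (m≤m+n 180 20) ⟩
  200 * (d₁ * d₂ * n₃)               ≡⟨ *-assoc 25 8 (d₁ * d₂ * n₃) ⟩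
  25 * (8 * (d₁ * d₂ * n₃))          ∎)
  where
  open ≤-Reasoning
  n₁ = doublingNum b₁ c₁
  n₂ = doublingNum b₂ c₂
  n₃ = doublingNum (b₁ + b₂) (c₁ + c₂)
  d₁ = doublingDen b₁ c₁
  d₂ = doublingDen b₂ c₂
  d₃ = doublingDen (b₁ + b₂) (c₁ + c₂)
  regroupˡ : ∀ n n′ d → 25 * (9 * (n * n′ * d)) ≡ 9 * (5 * n * (5 * n′) * d)
  regroupˡ = solve-∀
  regroupʳ : ∀ d d′ n → 9 * (2 * d * (2 * d′) * (5 * n)) ≡ 180 * (d * d′ * n)
  regroupʳ = solve-∀

-- The second inequality

-- With X = C(a₁, b₁) C(a₂, b₂) and Y = C(a, b), the squared second inequality reads
-- 9 · den · X² ≤ 4 · num · Y², i.e. twoThirdsˡ ≤ twoThirdsʳ, in the coordinates bᵢ and cᵢ = aᵢ − bᵢ.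
den num : ℕ → ℕ → ℕ → ℕ → ℕ
den b₁ c₁ b₂ c₂ = (b₁ + c₁ + (b₂ + c₂)) * (b₁ * c₁) * (b₂ * c₂)
num b₁ c₁ b₂ c₂ = (b₁ + b₂) * (c₁ + c₂) * (b₁ + c₁) * (b₂ + c₂)

den-scale : ∀ s b₁ c₁ b₂ c₂ →
  den (s * b₁) (s * c₁) (s * b₂) (s * c₂) ≡ s * (s * s * (s * s)) * den b₁ c₁ b₂ c₂
den-scale = unfolded
  where
  unfolded : ∀ s b₁ c₁ b₂ c₂ → (s * b₁ + s * c₁ + (s * b₂ + s * c₂)) * (s * b₁ * (s * c₁)) * (s * b₂ * (s * c₂))
                      ≡ s * (s * s * (s * s)) * ((b₁ + c₁ + (b₂ + c₂)) * (b₁ * c₁) * (b₂ * c₂))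
  unfolded = solve-∀

num-scale : ∀ s b₁ c₁ b₂ c₂ →
  num (s * b₁) (s * c₁) (s * b₂) (s * c₂) ≡ s * s * (s * s) * num b₁ c₁ b₂ c₂
num-scale = unfolded
  where
  unfolded : ∀ s b₁ c₁ b₂ c₂ → (s * b₁ + s * b₂) * (s * c₁ + s * c₂) * (s * b₁ + s * c₁) * (s * b₂ + s * c₂)
                      ≡ s * s * (s * s) * ((b₁ + b₂) * (c₁ + c₂) * (b₁ + c₁) * (b₂ + c₂))
  unfolded = solve-∀

twoThirdsˡ twoThirdsʳ : ℕ → ℕ → ℕ → ℕ → ℕ
twoThirdsˡ b₁ c₁ b₂ c₂ =
  9 * den b₁ c₁ b₂ c₂ * (binom b₁ c₁ * binom b₂ c₂ * (binom b₁ c₁ * binom b₂ c₂))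
twoThirdsʳ b₁ c₁ b₂ c₂ =
  4 * num b₁ c₁ b₂ c₂ * (binom (b₁ + b₂) (c₁ + c₂) * binom (b₁ + b₂) (c₁ + c₂))

twoThirdsʳ-nonZero : ∀ b₁ c₁ b₂ c₂ → .{{NonZero b₁}} → .{{NonZero c₁}} → .{{NonZero b₂}} →
                     NonZero (twoThirdsʳ b₁ c₁ b₂ c₂)
twoThirdsʳ-nonZero b₁@(suc _) c₁@(suc _) b₂@(suc _) c₂ =
  m*n≢0 (4 * num b₁ c₁ b₂ c₂) (Y * Y) {{_}} {{m*n≢0 Y Y {{Y≢0}} {{Y≢0}}}}
  where
  Y = binom (b₁ + b₂) (c₁ + c₂)
  Y≢0 = binom-nonZero (b₁ + b₂) (c₁ + c₂)

twoThirds-crude : ∀ b₁ c₁ b₂ c₂ →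
  4 * num b₁ c₁ b₂ c₂ * twoThirdsˡ b₁ c₁ b₂ c₂ ≤ 9 * den b₁ c₁ b₂ c₂ * twoThirdsʳ b₁ c₁ b₂ c₂
twoThirds-crude b₁ c₁ b₂ c₂ = begin
  4 * N * (9 * D * (X * X)) ≡⟨ regroupˡ N D (X * X) ⟩
  36 * (D * N) * (X * X)    ≤⟨ *-monoʳ-≤ (36 * (D * N)) (*-mono-≤ X≤Y X≤Y) ⟩
  36 * (D * N) * (Y * Y)    ≡⟨ regroupʳ N D (Y * Y) ⟩
  9 * D * (4 * N * (Y * Y)) ∎
  where
  open ≤-Reasoning
  D = den b₁ c₁ b₂ c₂
  N = num b₁ c₁ b₂ c₂
  X = binom b₁ c₁ * binom b₂ c₂
  Y = binom (b₁ + b₂) (c₁ + c₂)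
  X≤Y : X ≤ Y
  X≤Y = subst (X ≤_) (cong (_C (b₁ + b₂)) (+-interchange b₁ c₁ b₂ c₂))
              (mCj*nCk≤[m+n]C[j+k] (b₁ + c₁) b₁ (b₂ + c₂) b₂)
  regroupˡ : ∀ n d x → 4 * n * (9 * d * x) ≡ 36 * (d * n) * x
  regroupˡ = solve-∀
  regroupʳ : ∀ n d y → 36 * (d * n) * y ≡ 9 * d * (4 * n * y)
  regroupʳ = solve-∀

twoThirds-doubling : ∀ b₁ c₁ b₂ c₂ → .{{NonZero b₁}} → .{{NonZero c₁}} → .{{NonZero b₂}} →
  twoThirdsˡ b₁ c₁ b₂ c₂ * twoThirdsˡ b₁ c₁ b₂ c₂ * twoThirdsʳ (2 * b₁) (2 * c₁) (2 * b₂) (2 * c₂)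
    ≤ twoThirdsˡ (2 * b₁) (2 * c₁) (2 * b₂) (2 * c₂) * (twoThirdsʳ b₁ c₁ b₂ c₂ * twoThirdsʳ b₁ c₁ b₂ c₂)
twoThirds-doubling b₁ c₁ b₂ c₂ = begin
  L * L * (4 * num (2 * b₁) (2 * c₁) (2 * b₂) (2 * c₂) * (Y′ * Y′))
    ≡⟨ cong₂ (λ n z → L * L * (4 * n * (z * z))) (num-scale 2 b₁ c₁ b₂ c₂) Y′≡Y₂ ⟩
  L * L * (4 * (16 * N) * (Y₂ * Y₂))
    ≡⟨ regroupˡ D N X Y₂ ⟩
  576 * (D * N) * (9 * (D * (X * X * (X * X)) * (Y₂ * Y₂)))
    ≤⟨ *-monoʳ-≤ (576 * (D * N)) ratio ⟩
  576 * (D * N) * (8 * (N * (X₂ * X₂) * (Y * Y * (Y * Y))))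
    ≡⟨ regroupʳ D N X₂ Y ⟩
  9 * (32 * D) * (X₂ * X₂) * (R * R)
    ≡⟨ cong (λ d → 9 * d * (X₂ * X₂) * (R * R)) (den-scale 2 b₁ c₁ b₂ c₂) ⟨
  twoThirdsˡ (2 * b₁) (2 * c₁) (2 * b₂) (2 * c₂) * (R * R) ∎
  where
  open ≤-Reasoning
  D = den b₁ c₁ b₂ c₂
  N = num b₁ c₁ b₂ c₂
  X = binom b₁ c₁ * binom b₂ c₂
  Y = binom (b₁ + b₂) (c₁ + c₂)
  X₂ = binom (2 * b₁) (2 * c₁) * binom (2 * b₂) (2 * c₂)
  Y₂ = binom (2 * (b₁ + b₂)) (2 * (c₁ + c₂))
  Y′ = binom (2 * b₁ + 2 * b₂) (2 * c₁ + 2 * c₂)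
  L = twoThirdsˡ b₁ c₁ b₂ c₂
  R = twoThirdsʳ b₁ c₁ b₂ c₂
  Y′≡Y₂ : Y′ ≡ Y₂
  Y′≡Y₂ = sym (cong₂ binom (*-distribˡ-+ 2 b₁ b₂) (*-distribˡ-+ 2 c₁ c₂))
  numerators : ∀ b₁ c₁ b₂ c₂ B₁ B₂ E →
    b₁ * c₁ * (B₁ * B₁ * (B₁ * B₁)) * (b₂ * c₂ * (B₂ * B₂ * (B₂ * B₂))) * ((b₁ + b₂ + (c₁ + c₂)) * (E * E))
    ≡ (b₁ + c₁ + (b₂ + c₂)) * (b₁ * c₁) * (b₂ * c₂) * (B₁ * B₂ * (B₁ * B₂) * (B₁ * B₂ * (B₁ * B₂))) * (E * E)
  numerators = solve-∀
  denominators : ∀ b₁ c₁ b₂ c₂ E₁ E₂ B →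
    (b₁ + c₁) * (E₁ * E₁) * ((b₂ + c₂) * (E₂ * E₂)) * ((b₁ + b₂) * (c₁ + c₂) * (B * B * (B * B)))
    ≡ (b₁ + b₂) * (c₁ + c₂) * (b₁ + c₁) * (b₂ + c₂) * (E₁ * E₂ * (E₁ * E₂)) * (B * B * (B * B))
  denominators = solve-∀
  ratio : 9 * (D * (X * X * (X * X)) * (Y₂ * Y₂)) ≤ 8 * (N * (X₂ * X₂) * (Y * Y * (Y * Y)))
  ratio = subst₂ (λ u v → 9 * u ≤ 8 * v)
    (numerators b₁ c₁ b₂ c₂ (binom b₁ c₁) (binom b₂ c₂) Y₂)
    (denominators b₁ c₁ b₂ c₂ (binom (2 * b₁) (2 * c₁)) (binom (2 * b₂) (2 * c₂)) Y)
    (doubling-ratio b₁ c₁ b₂ c₂)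
  regroupˡ : ∀ d n x y → 9 * d * (x * x) * (9 * d * (x * x)) * (4 * (16 * n) * (y * y))
                       ≡ 576 * (d * n) * (9 * (d * (x * x * (x * x)) * (y * y)))
  regroupˡ = solve-∀
  regroupʳ : ∀ d n x y → 576 * (d * n) * (8 * (n * (x * x) * (y * y * (y * y))))
                       ≡ 9 * (32 * d) * (x * x) * (4 * n * (y * y) * (4 * n * (y * y)))
  regroupʳ = solve-∀

twoThirds : ∀ b₁ c₁ b₂ c₂ → .{{NonZero b₁}} → .{{NonZero c₁}} → .{{NonZero b₂}} →
            twoThirdsˡ b₁ c₁ b₂ c₂ ≤ twoThirdsʳ b₁ c₁ b₂ c₂
twoThirds b₁@(suc _) c₁@(suc _) b₂@(suc _) c₂ = subst₂ _≤_ (scaled-1 twoThirdsˡ) (scaled-1 twoThirdsʳ)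
  (tensor-power-trick P R (9 * D) R≢0 doubling linear)
  where
  open ≤-Reasoning
  D = den b₁ c₁ b₂ c₂
  N = num b₁ c₁ b₂ c₂
  scaled : (ℕ → ℕ → ℕ → ℕ → ℕ) → ℕ → ℕ
  scaled f s = f (s * b₁) (s * c₁) (s * b₂) (s * c₂)
  scaled-1 : ∀ f → scaled f 1 ≡ f b₁ c₁ b₂ c₂
  scaled-1 f rewrite *-identityˡ b₁ | *-identityˡ c₁ | *-identityˡ b₂ | *-identityˡ c₂ = refl
  scaled-2* : ∀ f s → scaled f (2 * s) ≡ f (2 * (s * b₁)) (2 * (s * c₁)) (2 * (s * b₂)) (2 * (s * c₂))
  scaled-2* f s rewrite *-assoc 2 s b₁ | *-assoc 2 s c₁ | *-assoc 2 s b₂ | *-assoc 2 s c₂ = refl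
  P R : ℕ → ℕ
  P k = scaled twoThirdsˡ (2 ^ k)
  R k = scaled twoThirdsʳ (2 ^ k)
  2^k*-nonZero : ∀ k x → .{{NonZero x}} → NonZero (2 ^ k * x)
  2^k*-nonZero k x = m*n≢0 (2 ^ k) x {{m^n≢0 2 k}}
  R≢0 : ∀ k → NonZero (R k)
  R≢0 k = twoThirdsʳ-nonZero _ _ _ _ {{2^k*-nonZero k b₁}} {{2^k*-nonZero k c₁}} {{2^k*-nonZero k b₂}}
  doubling : ∀ k → P k * P k * R (suc k) ≤ P (suc k) * (R k * R k)
  doubling k = subst₂ (λ r l → P k * P k * r ≤ l * (R k * R k))
    (sym (scaled-2* twoThirdsʳ (2 ^ k))) (sym (scaled-2* twoThirdsˡ (2 ^ k)))
    (twoThirds-doubling _ _ _ _ {{2^k*-nonZero k b₁}} {{2^k*-nonZero k c₁}} {{2^k*-nonZero k b₂}})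
  linear : ∀ k → P k ≤ 9 * D * 2 ^ k * R k
  linear k = ≤-trans (m≤n*m (P k) (4 * N)) (*-cancelˡ-≤ (s * s * (s * s)) {{s⁴≢0}} (begin
    s * s * (s * s) * (4 * N * P k)
      ≡⟨ regroupˡ (s * s * (s * s)) N (P k) ⟩
    4 * (s * s * (s * s) * N) * P k
      ≡⟨ cong (λ n → 4 * n * P k) (num-scale s b₁ c₁ b₂ c₂) ⟨
    4 * num (s * b₁) (s * c₁) (s * b₂) (s * c₂) * P k
      ≤⟨ twoThirds-crude (s * b₁) (s * c₁) (s * b₂) (s * c₂) ⟩
    9 * den (s * b₁) (s * c₁) (s * b₂) (s * c₂) * R k
      ≡⟨ cong (λ d → 9 * d * R k) (den-scale s b₁ c₁ b₂ c₂) ⟩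
    9 * (s * (s * s * (s * s)) * D) * R k
      ≡⟨ regroupʳ s (s * s * (s * s)) D (R k) ⟩
    s * s * (s * s) * (9 * D * s * R k) ∎))
    where
    s = 2 ^ k
    s⁴≢0 = m*n≢0 _ _ {{m*n≢0 s s {{m^n≢0 2 k}} {{m^n≢0 2 k}}}} {{m*n≢0 s s {{m^n≢0 2 k}} {{m^n≢0 2 k}}}}
    regroupˡ : ∀ t n p → t * (4 * n * p) ≡ 4 * (t * n) * p
    regroupˡ = solve-∀
    regroupʳ : ∀ s t d r → 9 * (s * t * d) * r ≡ t * (9 * d * s * r)
    regroupʳ = solve-∀


-- The third and fourth inequalities

power-step : ∀ b c k → .{{NonZero b}} → .{{NonZero c}} → .{{NonZero k}} →
  b * c * (binom b c * binom (k * b) (k * c) * (binom b c * binom (k * b) (k * c)))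
    ≤ (b + c) * (binom (suc k * b) (suc k * c) * binom (suc k * b) (suc k * c))
power-step b@(suc _) c@(suc _) k@(suc k′) = *-cancelˡ-≤ (9 * k) (*-cancelˡ-≤ M (begin
  M * (9 * k * (b * c * (X * X)))         ≡⟨ unfoldˡ b c k (X * X) ⟩
  twoThirdsˡ b c (k * b) (k * c)          ≤⟨ twoThirds b c (k * b) (k * c) ⟩
  twoThirdsʳ b c (k * b) (k * c)          ≡⟨ unfoldʳ b c k (Y * Y) ⟩
  M * (4 * suc k * ((b + c) * (Y * Y)))   ≤⟨ *-monoʳ-≤ M (*-monoˡ-≤ ((b + c) * (Y * Y)) 4[1+k]≤9k) ⟩
  M * (9 * k * ((b + c) * (Y * Y)))       ∎))
  where
  open ≤-Reasoning
  M = suc k * k * (b + c) * (b * c)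
  X = binom b c * binom (k * b) (k * c)
  Y = binom (suc k * b) (suc k * c)
  expand : ∀ k → 4 * suc (suc k) + (1 + 5 * k) ≡ 9 * suc k
  expand = solve-∀
  4[1+k]≤9k : 4 * suc k ≤ 9 * k
  4[1+k]≤9k = ≤-trans (m≤m+n _ (1 + 5 * k′)) (≤-reflexive (expand k′))
  unfoldˡ : ∀ b c k w → suc k * k * (b + c) * (b * c) * (9 * k * (b * c * w))
                      ≡ 9 * ((b + c + (k * b + k * c)) * (b * c) * (k * b * (k * c))) * w
  unfoldˡ = solve-∀
  unfoldʳ : ∀ b c k w → 4 * ((b + k * b) * (c + k * c) * (b + c) * (k * b + k * c)) * w
                      ≡ suc k * k * (b + c) * (b * c) * (4 * suc k * ((b + c) * w))
  unfoldʳ = solve-∀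

power-bound : ∀ b c k → .{{NonZero b}} → .{{NonZero c}} →
  binom b c ^ (2 * suc k) * (b * c) ^ k
    ≤ (b + c) ^ k * (binom (suc k * b) (suc k * c) * binom (suc k * b) (suc k * c))
power-bound b c zero = ≤-reflexive (trans (unit (binom b c))
  (cong (λ z → 1 * (z * z)) (sym (cong₂ binom (+-identityʳ b) (+-identityʳ c)))))
  where
  unit : ∀ x → x * (x * 1) * 1 ≡ 1 * (x * x)
  unit = solve-∀
power-bound b c (suc k) = begin
  B ^ (2 * suc (suc k)) * (b * c) ^ suc k
    ≡⟨ cong (λ e → B ^ e * (b * c) ^ suc k) (*-suc 2 (suc k)) ⟩
  B ^ (2 + 2 * suc k) * (b * c) ^ suc k
    ≡⟨ regroupˡ B (B ^ (2 * suc k)) (b * c) ((b * c) ^ k) ⟩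
  B * B * (b * c) * (B ^ (2 * suc k) * (b * c) ^ k)
    ≤⟨ *-monoʳ-≤ (B * B * (b * c)) (power-bound b c k) ⟩
  B * B * (b * c) * ((b + c) ^ k * (C * C))
    ≡⟨ regroupʳ B (b * c) ((b + c) ^ k) C ⟩
  (b + c) ^ k * (b * c * (B * C * (B * C)))
    ≤⟨ *-monoʳ-≤ ((b + c) ^ k) (power-step b c (suc k)) ⟩
  (b + c) ^ k * ((b + c) * (C′ * C′))
    ≡⟨ *-assoc ((b + c) ^ k) (b + c) (C′ * C′) ⟨
  (b + c) ^ k * (b + c) * (C′ * C′)
    ≡⟨ cong (_* (C′ * C′)) (*-comm ((b + c) ^ k) (b + c)) ⟩
  (b + c) ^ suc k * (C′ * C′) ∎
  where
  open ≤-Reasoning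
  B = binom b c
  C = binom (suc k * b) (suc k * c)
  C′ = binom (suc (suc k) * b) (suc (suc k) * c)
  regroupˡ : ∀ x y u v → x * (x * y) * (u * v) ≡ x * x * u * (y * v)
  regroupˡ = solve-∀
  regroupʳ : ∀ x u p y → x * x * u * (p * (y * y)) ≡ p * (u * (x * y * (x * y)))
  regroupʳ = solve-∀

via-complement : (Q : ℕ → ℕ → Set) → (∀ b c → .{{NonZero b}} → .{{NonZero c}} → Q (b + c) b) →
                 ∀ {a b} → 0 < b → b < a → Q a b
via-complement Q h {a} {b} 0<b b<a = subst (λ a → Q a b) (m+[n∸m]≡n (<⇒≤ b<a))
  (h b (a ∸ b) {{>-nonZero 0<b}} {{>-nonZero (m<n⇒0<n∸m b<a)}})

two-binom-bounds : ∀ b₁ c₁ b₂ c₂ → .{{NonZero b₁}} → .{{NonZero c₁}} → .{{NonZero b₂}} →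
                   TwoBinomBounds (b₁ + c₁) b₁ (b₂ + c₂) b₂
two-binom-bounds b₁ c₁ b₂ c₂ = mCj*nCk≤[m+n]C[j+k] (b₁ + c₁) b₁ (b₂ + c₂) b₂ , (begin
  9 * (a * (b₁ * (b₁ + c₁ ∸ b₁)) * (b₂ * (b₂ + c₂ ∸ b₂))) * X ^ 2
    ≡⟨ cong₂ (λ u v → 9 * (a * (b₁ * u) * (b₂ * v)) * X ^ 2) (m+n∸m≡n b₁ c₁) (m+n∸m≡n b₂ c₂) ⟩
  9 * den b₁ c₁ b₂ c₂ * X ^ 2
    ≡⟨ cong (9 * den b₁ c₁ b₂ c₂ *_) (m^2≡m*m X) ⟩
  twoThirdsˡ b₁ c₁ b₂ c₂
    ≤⟨ twoThirds b₁ c₁ b₂ c₂ ⟩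
  twoThirdsʳ b₁ c₁ b₂ c₂
    ≡⟨ cong₂ (λ u v → 4 * ((b₁ + b₂) * u * (b₁ + c₁) * (b₂ + c₂)) * v) a∸b≡c Y²≡Y*Y ⟨
  4 * ((b₁ + b₂) * (a ∸ (b₁ + b₂)) * (b₁ + c₁) * (b₂ + c₂)) * (a C (b₁ + b₂)) ^ 2 ∎)
  where
  open ≤-Reasoning
  a = b₁ + c₁ + (b₂ + c₂)
  X = binom b₁ c₁ * binom b₂ c₂
  a∸b≡c : a ∸ (b₁ + b₂) ≡ c₁ + c₂
  a∸b≡c = trans (cong (_∸ (b₁ + b₂)) (+-interchange b₁ c₁ b₂ c₂)) (m+n∸m≡n (b₁ + b₂) (c₁ + c₂))
  Y²≡Y*Y : (a C (b₁ + b₂)) ^ 2 ≡ binom (b₁ + b₂) (c₁ + c₂) * binom (b₁ + b₂) (c₁ + c₂)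
  Y²≡Y*Y = trans (cong (λ n → (n C (b₁ + b₂)) ^ 2) (+-interchange b₁ c₁ b₂ c₂))
                 (m^2≡m*m (binom (b₁ + b₂) (c₁ + c₂)))

power-bound-complement : ∀ k b c → .{{NonZero b}} → .{{NonZero c}} → PowerBound (b + c) b (suc k)
power-bound-complement k b c = subst₂ _≤_
  (sym (cong (λ z → binom b c ^ (2 * suc k) * (b * z) ^ k) (m+n∸m≡n b c)))
  (sym (cong ((b + c) ^ k *_) C²≡C*C))
  (power-bound b c k)
  where
  C²≡C*C : ((suc k * (b + c)) C (suc k * b)) ^ 2 ≡ binom (suc k * b) (suc k * c) * binom (suc k * b) (suc k * c)
  C²≡C*C = trans (cong (λ n → (n C (suc k * b)) ^ 2) (*-distribˡ-+ (suc k) b c))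
                 (m^2≡m*m (binom (suc k * b) (suc k * c)))

double-bound : ∀ b c → .{{NonZero b}} → .{{NonZero c}} → DoubleBound (b + c) b
double-bound b c =
    subst₂ _≤_ (sym (cong ((b + c) *_) D²≡D*D))
               (sym (cong₂ (λ z w → 16 * (b * z) * w) (m+n∸m≡n b c) (m^4≡m*m*[m*m] B)))
      (begin
        doublingDen b c                   ≤⟨ binom-double-upper b c ⟩
        5 * doublingNum b c               ≤⟨ *-monoˡ-≤ (doublingNum b c) (m≤m+n 5 11) ⟩
        16 * doublingNum b c              ≡⟨ *-assoc 16 (b * c) (B * B * (B * B)) ⟨
        16 * (b * c) * (B * B * (B * B))  ∎)
  , *-monoˡ-≤ (B ^ 4) (begin
        16 * (b * (b + c ∸ b))            ≡⟨ cong (λ z → 16 * (b * z)) (m+n∸m≡n b c) ⟩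
        16 * (b * c)                      ≡⟨ *-assoc 4 4 (b * c) ⟩
        4 * (4 * (b * c))                 ≤⟨ *-monoʳ-≤ 4 (4mn≤[m+n]² b c) ⟩
        4 * ((b + c) * (b + c))           ≡⟨ cong (4 *_) (m^2≡m*m (b + c)) ⟨
        4 * (b + c) ^ 2                   ∎)
  where
  open ≤-Reasoning
  B = binom b c
  D²≡D*D : ((2 * (b + c)) C (2 * b)) ^ 2 ≡ binom (2 * b) (2 * c) * binom (2 * b) (2 * c)
  D²≡D*D = trans (cong (λ n → (n C (2 * b)) ^ 2) (*-distribˡ-+ 2 b c)) (m^2≡m*m (binom (2 * b) (2 * c)))

corollary2 : (∀ a₁ b₁ a₂ b₂ → 0 < b₁ → b₁ < a₁ → 0 < b₂ → b₂ < a₂ → TwoBinomBounds a₁ b₁ a₂ b₂)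
    × (∀ a b k → 0 < b → b < a → 1 ≤ k → PowerBound a b k)
    × (∀ a b → 0 < b → b < a → DoubleBound a b)
corollary2 =
    (λ a₁ b₁ a₂ b₂ 0<b₁ b₁<a₁ 0<b₂ b₂<a₂ →
       via-complement (λ a₁ b₁ → TwoBinomBounds a₁ b₁ a₂ b₂)
         (λ b₁ c₁ → via-complement (TwoBinomBounds (b₁ + c₁) b₁)
                                    (λ b₂ c₂ → two-binom-bounds b₁ c₁ b₂ c₂) 0<b₂ b₂<a₂)
         0<b₁ b₁<a₁)
  , (λ { a b (suc k) 0<b b<a _ →
           via-complement (λ a b → PowerBound a b (suc k)) (power-bound-complement k) 0<b b<a })
  , (λ a b → via-complement DoubleBound double-bound)
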